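{- For any $1\le k\le n$, let $d:=\lfloor\log_2 k\rfloor+1$. In the U-MMB with $n$ leaves, the $k$-th most recent leaf $h_{n-k+1}$ lies in one of the $d$ rightmost mountains, and its mountain has height at most $d$.
   Context: A mountain of height $s\ge0$ is a perfect binary tree with $2^s$ leaves; its root is its peak. The U-MMB with $n$ leaves is an ordered (left-to-right) list of mountains whose leaves read left to right are $h_1,\dots,h_n$, defined inductively from the empty list: the $n$-th append (1) adds $h_n$ as a height-0 mountain at the right end, and (2) if there exist two consecutive mountains of equal height, takes the rightmost such pair, of height $s$, and replaces it in place by a mountain of height $s+1$ whose new peak has the two old peaks as children. -}

module Defs where

open import Data.Nat using (ℕ; zero; suc; _≟_)
open import Data.Product using (Σ; _,_)
open import Data.List using (List; []; _∷_; _++_; [_])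
open import Data.Maybe using (Maybe; just; nothing)
open import Relation.Nullary using (yes; no)
open import Relation.Binary.PropositionalEquality using (refl)

-- A perfect binary tree of height s (2^s leaves); leaves carry labels
-- (leaf h_i is labelled by its index i).
data Tree : ℕ → Set where
  leaf : ℕ → Tree zero
  node : ∀ {s} → Tree s → Tree s → Tree (suc s)

Mountain : Set
Mountain = Σ ℕ Tree

data _∈T_ (i : ℕ) : ∀ {s} → Tree s → Set where
  here  : i ∈T leaf i
  left  : ∀ {s} {l r : Tree s} → i ∈T l → i ∈T node l r
  right : ∀ {s} {l r : Tree s} → i ∈T r → i ∈T node l r

-- Merge the rightmost pair of consecutive mountains of equal height, if any
-- (lists are ordered left to right). The left mountain becomes the left child.
mergeRightmost : List Mountain → Maybe (List Mountain)
mergeRightmost [] = nothing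
mergeRightmost (x ∷ xs) with mergeRightmost xs
... | just ys = just (x ∷ ys)
... | nothing = pairAt x xs
  where
  pairAt : Mountain → List Mountain → Maybe (List Mountain)
  pairAt _ [] = nothing
  pairAt (s , t) ((s' , t') ∷ zs) with s ≟ s'
  ... | yes refl = just ((suc s , node t t') ∷ zs)
  ... | no _ = nothing

append : ℕ → List Mountain → List Mountain
append n ms with mergeRightmost (ms ++ [ (zero , leaf n) ])
... | just ms' = ms'
... | nothing  = ms ++ [ (zero , leaf n) ]

UMMB : ℕ → List Mountain
UMMB zero = []
UMMB (suc n) = append (suc n) (UMMB n)

{-# OPTIONS --safe #-}
-- Every mountain is at least as high as the number r of mountains to its right,
-- and at most one higher.  After a leaf is appended every height lies in
-- {r - 1, r}; the rightmost equal pair sits where the heights switch from r - 1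
-- to r, and merging it restores the invariant.  The r mountains strictly to the
-- right of h_{n-k+1} therefore hold at least 2^0 + ... + 2^(r-1) = 2^r - 1 leaves,
-- all more recent than it, so 2^r ≤ k, i.e. r ≤ ⌊log₂ k⌋; its own mountain has
-- height at most r + 1.
module Submission where

open import Defs
open import Data.Nat using (ℕ; zero; suc; _+_; _∸_; _≤_; _<_; _^_; _≟_; z≤n; s≤s)
open import Data.Nat.Properties
open import Data.Nat.Logarithm using (⌊log₂_⌋; ⌊log₂⌋-mono-≤; ⌊log₂[2^n]⌋≡n)
open import Data.Fin using (Fin; zero; suc; toℕ)
open import Data.List using (List; []; _∷_; _++_; [_]; length; lookup; concatMap; applyUpTo)
open import Data.List.Properties
  using (++-assoc; length-++; length-++-≤ʳ; ∷-injectiveʳ; concatMap-++; applyUpTo-∷ʳ; length-applyUpTo)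
open import Data.List.Membership.Propositional using (_∈_)
open import Data.List.Membership.Propositional.Properties using (∈-++⁻)
open import Data.List.Relation.Unary.Any using (here; there)
open import Data.Maybe using (Maybe; just; nothing)
open import Data.Product using (Σ; ∃; _×_; _,_; proj₁; proj₂)
open import Data.Sum using (_⊎_; inj₁; inj₂)
open import Function using (_∘_)
open import Relation.Nullary using (yes; no)
open import Relation.Binary.PropositionalEquality
  using (_≡_; refl; sym; trans; cong; cong₂; subst; module ≡-Reasoning)

suffix-++-split : ∀ {A : Set} (as : List A) {bs pre x rest} → as ++ bs ≡ pre ++ x ∷ rest →
  (∃ λ pre′ → bs ≡ pre′ ++ x ∷ rest) ⊎ (x ∈ as × length bs ≤ length rest)
suffix-++-split []       {pre = pre}     eq   = inj₁ (pre , eq)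
suffix-++-split (_ ∷ as) {bs} {[]}       refl = inj₂ (here refl , length-++-≤ʳ bs {as})
suffix-++-split (_ ∷ as) {pre = _ ∷ pre} eq with suffix-++-split as (∷-injectiveʳ eq)
... | inj₁ bs-suffix     = inj₁ bs-suffix
... | inj₂ (x∈as , bs≤) = inj₂ (there x∈as , bs≤)

applyUpTo-split : ∀ {A : Set} (f : ℕ → A) m j →
  applyUpTo f (m + suc j) ≡ applyUpTo f m ++ f m ∷ applyUpTo (λ i → f (suc m + i)) j
applyUpTo-split f zero    j = refl
applyUpTo-split f (suc m) j = cong (f 0 ∷_) (applyUpTo-split (f ∘ suc) m j)

leaves : ∀ {s} → Tree s → List ℕ
leaves (leaf i)   = [ i ]
leaves (node l r) = leaves l ++ leaves r

∈-leaves⁻ : ∀ {s} (t : Tree s) {x} → x ∈ leaves t → x ∈T t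
∈-leaves⁻ (leaf i)   (here refl) = here
∈-leaves⁻ (node l r) x∈ with ∈-++⁻ (leaves l) x∈
... | inj₁ x∈l = left (∈-leaves⁻ l x∈l)
... | inj₂ x∈r = right (∈-leaves⁻ r x∈r)

length-leaves : ∀ {s} (t : Tree s) → length (leaves t) ≡ 2 ^ s
length-leaves (leaf _) = refl
length-leaves {suc s} (node l r) = begin
  length (leaves l ++ leaves r)           ≡⟨ length-++ (leaves l) ⟩
  length (leaves l) + length (leaves r)   ≡⟨ cong₂ _+_ (length-leaves l) (length-leaves r) ⟩
  2 ^ s + 2 ^ s                           ≡⟨ cong (2 ^ s +_) (sym (+-identityʳ (2 ^ s))) ⟩
  2 ^ suc s                               ∎
  where open ≡-Reasoning

labels : List Mountain → List ℕ
labels = concatMap (leaves ∘ proj₂)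

-- P h r constrains the height h of a mountain that has r mountains to its right.
data Shape (P : ℕ → ℕ → Set) : List Mountain → Set where
  []  : Shape P []
  _∷_ : ∀ {h t ms} → P h (length ms) → Shape P ms → Shape P ((h , t) ∷ ms)

Shape-map : ∀ {P Q : ℕ → ℕ → Set} → (∀ {h r} → P h r → Q h r) → ∀ {ms} → Shape P ms → Shape Q ms
Shape-map f []       = []
Shape-map f (p ∷ ps) = f p ∷ Shape-map f ps

Tall Balanced PreMerge Staircase : List Mountain → Set
Tall      = Shape λ h r → r ≤ h
Balanced  = Shape λ h r → r ≤ h × h ≤ suc r
PreMerge  = Shape λ h r → h ≤ r × r ≤ suc h
Staircase = Shape λ h r → h ≡ r

Staircase⇒Balanced : ∀ {ms} → Staircase ms → Balanced ms
Staircase⇒Balanced = Shape-map λ { refl → ≤-refl , n≤1+n _ }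

2^length≤suc-length-labels : ∀ {ms} → Tall ms → 2 ^ length ms ≤ suc (length (labels ms))
2^length≤suc-length-labels {[]} [] = ≤-refl
2^length≤suc-length-labels {(h , t) ∷ ms} (r≤h ∷ tall) = begin
  2 ^ suc r                              ≡⟨ cong (2 ^ r +_) (+-identityʳ (2 ^ r)) ⟩
  2 ^ r + 2 ^ r                          ≤⟨ +-mono-≤ (^-monoʳ-≤ 2 r≤h) (2^length≤suc-length-labels tall) ⟩
  2 ^ h + suc (length (labels ms))       ≡⟨ +-suc (2 ^ h) _ ⟩
  suc (2 ^ h + length (labels ms))       ≡⟨ cong (λ l → suc (l + length (labels ms))) (sym (length-leaves t)) ⟩
  suc (length (leaves t) + length (labels ms)) ≡⟨ cong suc (sym (length-++ (leaves t))) ⟩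
  suc (length (labels ((h , t) ∷ ms)))   ∎
  where
  open ≤-Reasoning
  r = length ms

length≤⌊log₂⌋ : ∀ {ms k} → Tall ms → length (labels ms) < k → length ms ≤ ⌊log₂ k ⌋
length≤⌊log₂⌋ {ms} {k} tall few-labels = begin
  length ms                 ≡⟨ ⌊log₂[2^n]⌋≡n (length ms) ⟨
  ⌊log₂ (2 ^ length ms) ⌋   ≤⟨ ⌊log₂⌋-mono-≤ (≤-trans (2^length≤suc-length-labels tall) few-labels) ⟩
  ⌊log₂ k ⌋                 ∎
  where open ≤-Reasoning

data MergeOutcome (xs : List Mountain) : Maybe (List Mountain) → Set where
  unmerged : Staircase xs → MergeOutcome xs nothing
  merged   : ∀ {ys} → Balanced ys → length xs ≡ suc (length ys) → labels ys ≡ labels xs →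
             MergeOutcome xs (just ys)

mergeRightmost-outcome : ∀ xs → PreMerge xs → MergeOutcome xs (mergeRightmost xs)
mergeRightmost-outcome [] [] = unmerged []
mergeRightmost-outcome ((h , t) ∷ xs) ((h≤r , r≤1+h) ∷ pre)
  with mergeRightmost xs | mergeRightmost-outcome xs pre
... | just ys | merged balanced length≡ labels≡ =
  merged (bounds ∷ balanced) (cong suc length≡) (cong (leaves t ++_) labels≡)
  where
  bounds : length ys ≤ h × h ≤ suc (length ys)
  bounds = ≤-pred (subst (_≤ suc h) length≡ r≤1+h) , subst (h ≤_) length≡ h≤r
mergeRightmost-outcome ((h , t) ∷ []) ((h≤0 , _) ∷ []) | nothing | _ = unmerged (n≤0⇒n≡0 h≤0 ∷ [])
mergeRightmost-outcome ((h , t) ∷ (s , t′) ∷ zs) ((h≤r , r≤1+h) ∷ _) | nothing | unmerged (s≡r′ ∷ stair)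
  with h ≟ s
... | yes refl = merged (bounds ∷ Staircase⇒Balanced stair) refl (++-assoc (leaves t) (leaves t′) (labels zs))
  where
  bounds : length zs ≤ suc s × suc s ≤ suc (length zs)
  bounds = ≤-trans (≤-reflexive (sym s≡r′)) (n≤1+n s) , s≤s (≤-reflexive s≡r′)
... | no h≢s = unmerged (h≡r ∷ s≡r′ ∷ stair)
  where
  h≡r : h ≡ suc (length zs)
  h≡r = ≤-antisym h≤r (≤∧≢⇒< (≤-pred r≤1+h) (λ r′≡h → h≢s (trans (sym r′≡h) (sym s≡r′))))

preMerge-++-leaf : ∀ {ms} n → Balanced ms → PreMerge (ms ++ [ (zero , leaf n) ])
preMerge-++-leaf n [] = (z≤n , z≤n) ∷ []
preMerge-++-leaf {(h , _) ∷ ms} n ((r≤h , h≤1+r) ∷ balanced) =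
  subst (λ r → h ≤ r × r ≤ suc h) (sym length≡) (h≤1+r , s≤s r≤h) ∷ preMerge-++-leaf n balanced
  where
  length≡ : length (ms ++ [ (zero , leaf n) ]) ≡ suc (length ms)
  length≡ = trans (length-++ ms) (+-comm (length ms) 1)

append-balanced : ∀ {ms} n → Balanced ms → Balanced (append n ms)
append-balanced {ms} n balanced
  with mergeRightmost (ms ++ [ (zero , leaf n) ]) | mergeRightmost-outcome _ (preMerge-++-leaf n balanced)
... | just _  | merged balanced′ _ _ = balanced′
... | nothing | unmerged stair      = Staircase⇒Balanced stair

labels-append : ∀ {ms} n → Balanced ms → labels (append n ms) ≡ labels ms ++ [ n ]
labels-append {ms} n balanced
  with mergeRightmost (ms ++ [ (zero , leaf n) ]) | mergeRightmost-outcome _ (preMerge-++-leaf n balanced)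
... | just _  | merged _ _ labels≡ = trans labels≡ (concatMap-++ (leaves ∘ proj₂) ms _)
... | nothing | unmerged _         = concatMap-++ (leaves ∘ proj₂) ms _

UMMB-balanced : ∀ n → Balanced (UMMB n)
UMMB-balanced zero    = []
UMMB-balanced (suc n) = append-balanced (suc n) (UMMB-balanced n)

labels-UMMB : ∀ n → labels (UMMB n) ≡ applyUpTo suc n
labels-UMMB zero    = refl
labels-UMMB (suc n) = begin
  labels (UMMB (suc n))           ≡⟨ labels-append (suc n) (UMMB-balanced n) ⟩
  labels (UMMB n) ++ [ suc n ]    ≡⟨ cong (_++ [ suc n ]) (labels-UMMB n) ⟩
  applyUpTo suc n ++ [ suc n ]    ≡⟨ applyUpTo-∷ʳ suc n ⟩
  applyUpTo suc (suc n)           ∎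
  where open ≡-Reasoning

recent-label-location : ∀ {ms pre x rest k} → Balanced ms → labels ms ≡ pre ++ x ∷ rest → length rest < k →
  Σ (Fin (length ms)) λ p →
    x ∈T proj₂ (lookup ms p)
    × length ms ≤ toℕ p + (⌊log₂ k ⌋ + 1)
    × proj₁ (lookup ms p) ≤ ⌊log₂ k ⌋ + 1
recent-label-location {pre = []}    [] ()
recent-label-location {pre = _ ∷ _} [] ()
recent-label-location {(_ , t) ∷ _} (_ ∷ balanced) eq rest<k
  with suffix-++-split (leaves t) eq
... | inj₁ (pre′ , eq′) with recent-label-location balanced eq′ rest<k
...   | p , x∈ , length≤ , height≤ = suc p , x∈ , s≤s length≤ , height≤
recent-label-location {(_ , t) ∷ ms} {k = k} ((_ , h≤1+r) ∷ balanced) eq rest<k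
    | inj₂ (x∈t , labels≤rest) = zero , ∈-leaves⁻ t x∈t , 1+r≤d , ≤-trans h≤1+r 1+r≤d
  where
  1+r≤d : suc (length ms) ≤ ⌊log₂ k ⌋ + 1
  1+r≤d = subst (suc (length ms) ≤_) (+-comm 1 ⌊log₂ k ⌋)
    (s≤s (length≤⌊log₂⌋ (Shape-map proj₁ balanced) (≤-<-trans labels≤rest rest<k)))

lemma5 : (n k : ℕ) → 1 ≤ k → k ≤ n →
    Σ (Fin (length (UMMB n))) λ p →
      ((n ∸ k) + 1) ∈T proj₂ (lookup (UMMB n) p)
      × length (UMMB n) ≤ toℕ p + (⌊log₂ k ⌋ + 1)
      × proj₁ (lookup (UMMB n) p) ≤ ⌊log₂ k ⌋ + 1
lemma5 n (suc j) _ k≤n =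
  recent-label-location (UMMB-balanced n) labels-split (s≤s (≤-reflexive (length-applyUpTo _ j)))
  where
  m = n ∸ suc j
  later = applyUpTo (λ i → suc (suc m + i)) j
  labels-split : labels (UMMB n) ≡ applyUpTo suc m ++ (m + 1) ∷ later
  labels-split = begin
    labels (UMMB n)                   ≡⟨ labels-UMMB n ⟩
    applyUpTo suc n                   ≡⟨ cong (applyUpTo suc) (m∸n+n≡m k≤n) ⟨
    applyUpTo suc (m + suc j)         ≡⟨ applyUpTo-split suc m j ⟩
    applyUpTo suc m ++ suc m ∷ later  ≡⟨ cong (λ y → applyUpTo suc m ++ y ∷ later) (+-comm 1 m) ⟩
    applyUpTo suc m ++ (m + 1) ∷ later ∎
    where open ≡-Reasoning
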